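{- Let $k\geq 1$ and let $F$ be an unsatisfiable $k$-CNF formula containing a variable $x$ that occurs positively in exactly $p$ clauses and negatively in exactly $q$ clauses. Then $F$ has at least $2^k+|q-p|$ clauses.
   Context: A literal is a propositional variable $x$ or its negation $\overline{x}$; a clause is a finite set of literals not containing both a literal and its negation; a CNF formula is a finite set of clauses. A $k$-CNF formula is a CNF formula in which every clause contains exactly $k$ literals. -}

module Defs where

open import Data.Nat using (ℕ; _≤_; _^_; _<_; _+_; ∣_-_∣)
open import Data.Bool using (Bool; true; false; not)
open import Data.Bool.Properties using () renaming (_≟_ to _≟ᵇ_)
open import Data.Nat.Properties using () renaming (_≟_ to _≟ℕ_)
open import Data.Sum using (_⊎_)
open import Data.Product using (_×_; _,_; ∃)
open import Data.Product.Properties using (≡-dec)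
open import Data.List using (List; length; filter)
open import Data.List.Relation.Unary.All using (All)
open import Data.List.Relation.Unary.Any using (Any)
open import Data.List.Relation.Unary.AllPairs using (AllPairs)
open import Data.List.Relation.Unary.Unique.Propositional using (Unique)
open import Data.List.Relation.Binary.Permutation.Propositional using (_↭_)
open import Relation.Binary.PropositionalEquality using (_≡_)
open import Relation.Binary.Definitions using (DecidableEquality)
open import Relation.Nullary using (¬_)

Literal : Set
Literal = ℕ × Bool

pos neg : ℕ → Literal
pos x = x , true
neg x = x , false

complement : Literal → Literal
complement (x , b) = x , not b

_≟L_ : DecidableEquality Literal
_≟L_ = ≡-dec _≟ℕ_ _≟ᵇ_

open import Data.List.Membership.DecPropositional _≟L_ public using (_∈_; _∈?_)

Clause : Set
Clause = List Literal

IsClause : Clause → Set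
IsClause C = Unique C × (∀ l → l ∈ C → ¬ (complement l ∈ C))

-- A CNF formula is a finite set of clauses: a list of clauses, no two of
-- which are equal as sets (i.e. permutations of each other).
CNF : Set
CNF = List Clause

IsCNF : CNF → Set
IsCNF F = All IsClause F × AllPairs (λ C D → ¬ (C ↭ D)) F

IsKCNF : ℕ → CNF → Set
IsKCNF k F = IsCNF F × All (λ C → length C ≡ k) F

Assignment : Set
Assignment = ℕ → Bool

litTrue : Assignment → Literal → Set
litTrue α (x , b) = α x ≡ b

clauseSat : Assignment → Clause → Set
clauseSat α C = Any (litTrue α) C

Satisfies : Assignment → CNF → Set
Satisfies α F = All (clauseSat α) F

Unsatisfiable : CNF → Set
Unsatisfiable F = ∀ (α : Assignment) → ¬ Satisfies α F

occurrences : Literal → CNF → ℕ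
occurrences l F = length (filter (l ∈?_) F)

Occurs : ℕ → CNF → Set
Occurs x F = Any (λ C → pos x ∈ C) F ⊎ Any (λ C → neg x ∈ C) F

-- Setting a literal l of x to true turns F into a formula F|ₗ that is still
-- unsatisfiable. A CNF G with  Σ_{C ∈ G} 2^(k - |C|) < 2^k  is satisfiable,
-- because for every variable one of its two restrictions does not increase
-- this weight; so F|ₗ has weight at least 2^k. In F|ₗ the clauses containing l
-- disappear, those containing l̄ have length k - 1 (weight 2) and the others
-- keep weight 1, which gives  2^k + #l ≤ |F| + #l̄,  where #l counts the
-- clauses containing l. Taking l = x and l = x̄ yields  2^k + |q - p| ≤ |F|.
module Submission where

open import Defs
open import Data.Nat using (ℕ; suc; z≤n; s≤s; _≟_; _≤_; _<_; _^_; _+_; _∸_; ∣_-_∣; _≤?_)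
open import Data.Nat.Properties
open import Data.Nat.Induction using (<-wellFounded)
open import Induction.WellFounded using (Acc; acc)
open import Data.Bool using (true; false; not)
open import Data.Bool.Properties using (¬-not; not-involutive)
open import Data.Product using (_,_; ∃; proj₁)
open import Data.Sum using (_⊎_; inj₁; inj₂)
open import Data.List using ([]; _∷_; length; filter; map)
open import Data.Nat.ListAction using (sum)
open import Data.List.Properties using (length-filter; filter-all; filter-notAll)
open import Data.List.Relation.Unary.All as All using (All; []; _∷_)
open import Data.List.Relation.Unary.All.Properties using (¬Any⇒All¬; All¬⇒¬Any)
open import Data.List.Relation.Unary.Any as Any using (here)
open import Data.List.Relation.Unary.AllPairs using (_∷_)
open import Data.List.Relation.Unary.Unique.Propositional using (Unique)
import Data.List.Relation.Unary.Unique.Propositional.Properties as Unique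
open import Data.List.Membership.Propositional using (find; lose)
open import Data.List.Membership.Propositional.Properties using (∈-filter⁻; ∈-length)
open import Relation.Binary.PropositionalEquality
  using (_≡_; _≢_; refl; sym; trans; cong; cong₂; subst; ≢-sym)
open import Relation.Nullary using (¬_; yes; no; ¬?; contradiction)
open import Algebra.Properties.CommutativeSemigroup +-commutativeSemigroup
  using (interchange)

m+n≤o+o⇒m≤o⊎n≤o : ∀ m n o → m + n ≤ o + o → m ≤ o ⊎ n ≤ o
m+n≤o+o⇒m≤o⊎n≤o m n o m+n≤o+o with m ≤? o
... | yes m≤o = inj₁ m≤o
... | no m≰o  = inj₂ (+-cancelˡ-≤ o n o (begin
  o + n ≤⟨ +-monoˡ-≤ n (<⇒≤ (≰⇒> m≰o)) ⟩
  m + n ≤⟨ m+n≤o+o ⟩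
  o + o ∎))
  where open ≤-Reasoning

+∸≤ : ∀ a {m n} L → n ≤ m → a + m ≤ L + n → a + (m ∸ n) ≤ L
+∸≤ a {m} {n} L n≤m a+m≤L+n = +-cancelʳ-≤ n (a + (m ∸ n)) L (begin
  a + (m ∸ n) + n   ≡⟨ +-assoc a (m ∸ n) n ⟩
  a + (m ∸ n + n)   ≡⟨ cong (a +_) (m∸n+n≡m n≤m) ⟩
  a + m             ≤⟨ a+m≤L+n ⟩
  L + n             ∎)
  where open ≤-Reasoning

+∣-∣≤ : ∀ a {p q} L → a + p ≤ L + q → a + q ≤ L + p → a + ∣ q - p ∣ ≤ L
+∣-∣≤ a {p} {q} L a+p≤L+q a+q≤L+p with ≤-total p q
... | inj₁ p≤q = subst (λ d → a + d ≤ L) (sym (m≤n⇒∣n-m∣≡n∸m p≤q))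
                       (+∸≤ a L p≤q a+q≤L+p)
... | inj₂ q≤p = subst (λ d → a + d ≤ L) (sym (m≤n⇒∣m-n∣≡n∸m q≤p))
                       (+∸≤ a L q≤p a+p≤L+q)

delete : Literal → Clause → Clause
delete l = filter (λ m → ¬? (m ≟L l))

delete-∉ : ∀ {l C} → ¬ l ∈ C → delete l C ≡ C
delete-∉ {l} {C} l∉C = filter-all (λ m → ¬? (m ≟L l)) (All.map ≢-sym (¬Any⇒All¬ C l∉C))

length-delete-< : ∀ {l C} → l ∈ C → length (delete l C) < length C
length-delete-< {l} {C} l∈C =
  filter-notAll (λ m → ¬? (m ≟L l)) C (Any.map (λ l≡m m≢l → m≢l (sym l≡m)) l∈C)

length≤1+length-delete : ∀ l {C} → Unique C → length C ≤ suc (length (delete l C))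
length≤1+length-delete l {[]} _ = z≤n
length≤1+length-delete l {m ∷ C} (m∉C ∷ uniqueC) with m ≟L l
... | yes refl = s≤s (≤-reflexive (sym (cong length (delete-∉ (All¬⇒¬Any m∉C)))))
... | no _     = s≤s (length≤1+length-delete l uniqueC)

length-delete-≤ : ∀ l C → length (delete l C) ≤ length C
length-delete-≤ l = length-filter (λ m → ¬? (m ≟L l))

restrict : Literal → CNF → CNF
restrict l [] = []
restrict l (C ∷ G) with l ∈? C
... | yes _ = restrict l G
... | no _  = delete (complement l) C ∷ restrict l G

All-Unique-restrict : ∀ l {G} → All Unique G → All Unique (restrict l G)
All-Unique-restrict l {[]} [] = []
All-Unique-restrict l {C ∷ G} (uniqueC ∷ uniqueG) with l ∈? C
... | yes _ = All-Unique-restrict l uniqueG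
... | no _  = Unique.filter⁺ (λ m → ¬? (m ≟L complement l)) uniqueC ∷ All-Unique-restrict l uniqueG

size : CNF → ℕ
size G = sum (map length G)

size-restrict-≤ : ∀ l G → size (restrict l G) ≤ size G
size-restrict-≤ l [] = z≤n
size-restrict-≤ l (C ∷ G) with l ∈? C
... | yes _ = ≤-trans (size-restrict-≤ l G) (m≤n+m (size G) (length C))
... | no _  = +-mono-≤ (length-delete-≤ (complement l) C) (size-restrict-≤ l G)

other-polarity-∈ : ∀ {v b c C} → (v , b) ∈ C → ¬ (v , c) ∈ C → (v , not c) ∈ C
other-polarity-∈ {v} {C = C} vb∈C vc∉C =
  subst (λ b → (v , b) ∈ C) (¬-not (λ { refl → vc∉C vb∈C })) vb∈C

size-restrict-< : ∀ {v b} c C G → (v , b) ∈ C → size (restrict (v , c) (C ∷ G)) < size (C ∷ G)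
size-restrict-< {v} c C G vb∈C with (v , c) ∈? C
... | yes vc∈C = +-mono-<-≤ (∈-length vc∈C) (size-restrict-≤ (v , c) G)
... | no vc∉C  = +-mono-<-≤ (length-delete-< (other-polarity-∈ vb∈C vc∉C)) (size-restrict-≤ (v , c) G)

clauseWeight : ℕ → Clause → ℕ
clauseWeight N C = 2 ^ (N ∸ length C)

-- 2^N · Σ_{C ∈ G} 2^(-|C|), except that clauses longer than N get weight 1
-- because of truncated subtraction; this only overestimates.
weight : ℕ → CNF → ℕ
weight N G = sum (map (clauseWeight N) G)

clauseWeight-length : ∀ N {C} → length C ≡ N → clauseWeight N C ≡ 1
clauseWeight-length N refl = cong (2 ^_) (n∸n≡0 N)

2^[n∸m]≤2^[n∸o]+2^[n∸o] : ∀ n {m o} → o ≤ suc m → 2 ^ (n ∸ m) ≤ 2 ^ (n ∸ o) + 2 ^ (n ∸ o)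
2^[n∸m]≤2^[n∸o]+2^[n∸o] n {m} {o} o≤1+m = begin
  2 ^ (n ∸ m)      ≤⟨ ^-monoʳ-≤ 2 (m≤n+o⇒m∸n≤o n m n≤m+1+[n∸o]) ⟩
  2 ^ suc (n ∸ o)  ≡⟨ cong (2 ^ (n ∸ o) +_) (+-identityʳ (2 ^ (n ∸ o))) ⟩
  2 ^ (n ∸ o) + 2 ^ (n ∸ o) ∎
  where
  open ≤-Reasoning
  n≤m+1+[n∸o] : n ≤ m + suc (n ∸ o)
  n≤m+1+[n∸o] = begin
    n                  ≤⟨ m≤n+m∸n n o ⟩
    o + (n ∸ o)        ≤⟨ +-monoˡ-≤ (n ∸ o) o≤1+m ⟩
    suc m + (n ∸ o)    ≡⟨ sym (+-suc m (n ∸ o)) ⟩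
    m + suc (n ∸ o)    ∎

clauseWeight-delete-≤ : ∀ N l {C} → Unique C →
                        clauseWeight N (delete l C) ≤ clauseWeight N C + clauseWeight N C
clauseWeight-delete-≤ N l uniqueC = 2^[n∸m]≤2^[n∸o]+2^[n∸o] N (length≤1+length-delete l uniqueC)

restrictedWeight : ℕ → Literal → Clause → ℕ
restrictedWeight N l C with l ∈? C
... | yes _ = 0
... | no _  = clauseWeight N (delete (complement l) C)

weight-restrict-∷ : ∀ N l C G →
  weight N (restrict l (C ∷ G)) ≡ restrictedWeight N l C + weight N (restrict l G)
weight-restrict-∷ N l C G with l ∈? C
... | yes _ = refl
... | no _  = refl

occurrences-∷ : ∀ l C F → occurrences l (C ∷ F) ≡ occurrences l (C ∷ []) + occurrences l F
occurrences-∷ l C F with l ∈? C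
... | yes _ = refl
... | no _  = refl

restrictedWeight-pos+neg : ∀ N v {C} → Unique C →
  restrictedWeight N (pos v) C + restrictedWeight N (neg v) C ≤ clauseWeight N C + clauseWeight N C
restrictedWeight-pos+neg N v {C} uniqueC with (v , true) ∈? C | (v , false) ∈? C
... | yes _  | yes _   = z≤n
... | yes _  | no _    = clauseWeight-delete-≤ N (pos v) uniqueC
... | no _   | yes _   =
  subst (_≤ _) (sym (+-identityʳ _)) (clauseWeight-delete-≤ N (neg v) uniqueC)
... | no v∉C | no v̄∉C rewrite delete-∉ v∉C | delete-∉ v̄∉C = ≤-refl

weight-restrict-pos+neg : ∀ N v G → All Unique G →
  weight N (restrict (pos v) G) + weight N (restrict (neg v) G) ≤ weight N G + weight N G
weight-restrict-pos+neg N v [] [] = z≤n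
weight-restrict-pos+neg N v (C ∷ G) (uniqueC ∷ uniqueG) = begin
  weight N (restrict (pos v) (C ∷ G)) + weight N (restrict (neg v) (C ∷ G))
    ≡⟨ cong₂ _+_ (weight-restrict-∷ N (pos v) C G) (weight-restrict-∷ N (neg v) C G) ⟩
  (r⁺ + W⁺) + (r⁻ + W⁻) ≡⟨ interchange r⁺ W⁺ r⁻ W⁻ ⟩
  (r⁺ + r⁻) + (W⁺ + W⁻) ≤⟨ +-mono-≤ (restrictedWeight-pos+neg N v uniqueC)
                                    (weight-restrict-pos+neg N v G uniqueG) ⟩
  (w + w) + (W + W)     ≡⟨ interchange w w W W ⟩
  (w + W) + (w + W)     ∎
  where
  open ≤-Reasoning
  r⁺ = restrictedWeight N (pos v) C
  r⁻ = restrictedWeight N (neg v) C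
  W⁺ = weight N (restrict (pos v) G)
  W⁻ = weight N (restrict (neg v) G)
  w  = clauseWeight N C
  W  = weight N G

∃-weight-restrict≤ : ∀ N v G → All Unique G → ∃ λ c → weight N (restrict (v , c) G) ≤ weight N G
∃-weight-restrict≤ N v G uniqueG with m+n≤o+o⇒m≤o⊎n≤o (weight N (restrict (pos v) G))
  (weight N (restrict (neg v) G)) (weight N G) (weight-restrict-pos+neg N v G uniqueG)
... | inj₁ W⁺≤W = true , W⁺≤W
... | inj₂ W⁻≤W = false , W⁻≤W

set : Literal → Assignment → Assignment
set (v , c) α u with u ≟ v
... | yes _ = c
... | no _  = α u

set-satisfies : ∀ l α → litTrue (set l α) l
set-satisfies (v , c) α with v ≟ v
... | yes _   = refl
... | no v≢v  = contradiction refl v≢v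

set-preserves : ∀ l α {m} → m ≢ complement l → litTrue α m → litTrue (set l α) m
set-preserves (v , c) α {u , d} m≢l̄ αm with u ≟ v
... | yes refl = sym (trans (¬-not (λ d≡c̄ → m≢l̄ (cong (u ,_) d≡c̄))) (not-involutive c))
... | no _     = αm

clauseSat-delete : ∀ l α C → clauseSat α (delete (complement l) C) → clauseSat (set l α) C
clauseSat-delete l α C sat =
  let m , m∈C′ , αm = find sat
      m∈C , m≢l̄    = ∈-filter⁻ (λ m → ¬? (m ≟L complement l)) m∈C′
  in lose m∈C (set-preserves l α m≢l̄ αm)

satisfies-restrict⇒satisfies-set : ∀ l α G → Satisfies α (restrict l G) → Satisfies (set l α) G
satisfies-restrict⇒satisfies-set l α [] [] = []
satisfies-restrict⇒satisfies-set l α (C ∷ G) sat with l ∈? C | sat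
... | yes l∈C | satG        =
  lose l∈C (set-satisfies l α) ∷ satisfies-restrict⇒satisfies-set l α G satG
... | no _    | satC ∷ satG =
  clauseSat-delete l α C satC ∷ satisfies-restrict⇒satisfies-set l α G satG

satisfiable-if-weight< : ∀ N G → All Unique G → weight N G < 2 ^ N → ∃ λ α → Satisfies α G
satisfiable-if-weight< N G = go G (<-wellFounded (size G))
  where
  go : ∀ G → Acc _<_ (size G) → All Unique G → weight N G < 2 ^ N → ∃ λ α → Satisfies α G
  go [] _ _ _ = (λ _ → true) , []
  go ([] ∷ G) _ _ weight<2^N = contradiction weight<2^N (m+n≮m (2 ^ N) (weight N G))
  go (C@((v , b) ∷ _) ∷ G) (acc rec) uniqueCG weight<2^N =
    let c , weight≤ = ∃-weight-restrict≤ N v (C ∷ G) uniqueCG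
        α , sat     = go (restrict (v , c) (C ∷ G))
                         (rec (size-restrict-< c C G (here refl)))
                         (All-Unique-restrict (v , c) uniqueCG)
                         (≤-<-trans weight≤ weight<2^N)
    in set (v , c) α , satisfies-restrict⇒satisfies-set (v , c) α (C ∷ G) sat

occurrence+restrictedWeight≤ : ∀ k l {C} → IsClause C → length C ≡ k →
  occurrences l (C ∷ []) + restrictedWeight k l C ≤ 1 + occurrences (complement l) (C ∷ [])
occurrence+restrictedWeight≤ k l@(v , c) {C} (uniqueC , consistentC) |C|≡k
  with l ∈? C | (v , not c) ∈? C
... | yes l∈C | yes l̄∈C = contradiction l̄∈C (consistentC l l∈C)
... | yes _   | no _    = ≤-refl
... | no _    | yes _   = subst (clauseWeight k (delete (v , not c) C) ≤_)
  (cong (λ w → w + w) (clauseWeight-length k {C} |C|≡k)) (clauseWeight-delete-≤ k (v , not c) uniqueC)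
... | no _    | no l̄∉C  =
  ≤-reflexive (trans (cong (clauseWeight k) (delete-∉ l̄∉C)) (clauseWeight-length k {C} |C|≡k))

occurrences+weight-restrict≤ : ∀ k l F → All IsClause F → All (λ C → length C ≡ k) F →
  occurrences l F + weight k (restrict l F) ≤ length F + occurrences (complement l) F
occurrences+weight-restrict≤ k l [] [] [] = z≤n
occurrences+weight-restrict≤ k l (C ∷ F) (isClauseC ∷ isClauseF) (|C|≡k ∷ |F|≡k) = begin
  occurrences l (C ∷ F) + weight k (restrict l (C ∷ F))
    ≡⟨ cong₂ _+_ (occurrences-∷ l C F) (weight-restrict-∷ k l C F) ⟩
  (o + O) + (r + W)   ≡⟨ interchange o O r W ⟩
  (o + r) + (O + W)   ≤⟨ +-mono-≤ (occurrence+restrictedWeight≤ k l isClauseC |C|≡k)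
                                  (occurrences+weight-restrict≤ k l F isClauseF |F|≡k) ⟩
  (1 + ō) + (L + Ō)   ≡⟨ interchange 1 ō L Ō ⟩
  (1 + L) + (ō + Ō)   ≡⟨ cong (suc L +_) (sym (occurrences-∷ (complement l) C F)) ⟩
  length (C ∷ F) + occurrences (complement l) (C ∷ F) ∎
  where
  open ≤-Reasoning
  o = occurrences l (C ∷ [])
  O = occurrences l F
  r = restrictedWeight k l C
  W = weight k (restrict l F)
  ō = occurrences (complement l) (C ∷ [])
  Ō = occurrences (complement l) F
  L = length F

2^k≤weight-restrict : ∀ k l F → All Unique F → Unsatisfiable F → 2 ^ k ≤ weight k (restrict l F)
2^k≤weight-restrict k l F uniqueF unsat = ≮⇒≥ λ weight<2^k →
  let α , sat = satisfiable-if-weight< k (restrict l F) (All-Unique-restrict l uniqueF) weight<2^k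
  in unsat (set l α) (satisfies-restrict⇒satisfies-set l α F sat)

2^k+occurrences≤ : ∀ k l F → IsKCNF k F → Unsatisfiable F →
  2 ^ k + occurrences l F ≤ length F + occurrences (complement l) F
2^k+occurrences≤ k l F ((isClauseF , _) , |F|≡k) unsat = begin
  2 ^ k + occurrences l F
    ≡⟨ +-comm (2 ^ k) (occurrences l F) ⟩
  occurrences l F + 2 ^ k
    ≤⟨ +-monoʳ-≤ (occurrences l F) (2^k≤weight-restrict k l F (All.map proj₁ isClauseF) unsat) ⟩
  occurrences l F + weight k (restrict l F)
    ≤⟨ occurrences+weight-restrict≤ k l F isClauseF |F|≡k ⟩
  length F + occurrences (complement l) F ∎
  where open ≤-Reasoning

lemma2 : (k : ℕ) → 1 ≤ k → (F : CNF) → IsKCNF k F → Unsatisfiable F →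
    (x p q : ℕ) → Occurs x F →
    occurrences (pos x) F ≡ p → occurrences (neg x) F ≡ q →
    2 ^ k + ∣ q - p ∣ ≤ length F
lemma2 k _ F kcnfF unsat x p q _ refl refl =
  +∣-∣≤ (2 ^ k) (length F) (2^k+occurrences≤ k (pos x) F kcnfF unsat)
                            (2^k+occurrences≤ k (neg x) F kcnfF unsat)
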